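{- For every integer $d\ge 3$, $$M(d)=2N^{+}(d)+2N^{ - }(d)+4+\delta(d),$$ where $\delta(d)=1$ if $d$ is even and $\delta(d)=0$ if $d$ is odd.
   Context: A pair $(a,b)\in\mathbb{Z}^2$ is multiplicatively dependent if $ab\neq 0$ and there is $(k_1,k_2)\in\mathbb{Z}^2\setminus\{(0,0)\}$ with $a^{k_1}b^{k_2}=1$. For $d\in\mathbb{Z}$, $\mathcal{M}(d)$ is the set of multiplicatively dependent pairs $(a,b)\in\mathbb{Z}^2$ with $ab\ne 0$ and $b-a=d$, and $M(d)=|\mathcal{M}(d)|$. For an integer $d\ge1$, an integer solution $(g,x,y)$ of $g^y+g^x=d$ with $g\ge 2$ and $y>x\ge 1$ is primitive if $g$ is not a perfect power; $N^{+}(d)$ is the number of primitive solutions of this equation. Likewise $N^{ - }(d)$ is the number of integer solutions $(g,x,y)$ of $g^y-g^x=d$ with $g\ge2$, $y>x\ge1$ and $g$ not a perfect power. -}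

module Defs where

open import Data.Nat as ℕ using (ℕ; zero; suc; _≤_; _<_)
open import Data.Integer as ℤ using (ℤ; +_; -[1+_]; 0ℤ)
open import Data.Product using (Σ; ∃; ∃-syntax; _×_; _,_)
open import Data.List using (List; length)
open import Data.List.Membership.Propositional using (_∈_)
open import Data.List.Relation.Unary.Unique.Propositional using (Unique)
open import Function.Bundles using (_⇔_)
open import Relation.Binary.PropositionalEquality using (_≡_)
open import Relation.Nullary using (¬_)

HasCard : {A : Set} → (A → Set) → ℕ → Set
HasCard {A} P n =
  Σ (List A) λ xs → Unique xs × length xs ≡ n × (∀ x → (x ∈ xs) ⇔ P x)

posPart : ℤ → ℕ
posPart (+ n)    = n
posPart -[1+ n ] = 0

negPart : ℤ → ℕ
negPart (+ n)    = 0
negPart -[1+ n ] = suc n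

-- For nonzero a, b the rational identity a^k1 b^k2 = 1
-- is written with negative exponents moved to the other side:
-- a^(k1⁺) b^(k2⁺) = a^(k1⁻) b^(k2⁻)  (an identity in ℤ).
MultDep : ℤ → ℤ → Set
MultDep a b =
  ¬ (a ℤ.* b ≡ 0ℤ) ×
  ∃[ k1 ] ∃[ k2 ] (¬ ((k1 ≡ 0ℤ) × (k2 ≡ 0ℤ)) ×
    (a ℤ.^ posPart k1) ℤ.* (b ℤ.^ posPart k2)
      ≡ (a ℤ.^ negPart k1) ℤ.* (b ℤ.^ negPart k2))

InM : ℤ → ℤ × ℤ → Set
InM d (a , b) = ¬ (a ℤ.* b ≡ 0ℤ) × MultDep a b × (b ℤ.- a ≡ d)

IsPerfectPower : ℕ → Set
IsPerfectPower g = ∃[ m ] ∃[ k ] (2 ≤ k × g ≡ m ℕ.^ k)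

PlusSol : ℕ → ℕ × ℕ × ℕ → Set
PlusSol d (g , x , y) =
  2 ≤ g × 1 ≤ x × x < y × ¬ IsPerfectPower g × g ℕ.^ y ℕ.+ g ℕ.^ x ≡ d

-- solutions (g,x,y) of g^y - g^x = d with g not a perfect power
-- (y > x ≥ 1, g ≥ 2 give g^y > g^x, so this is g^y = d + g^x in ℕ)
MinusSol : ℕ → ℕ × ℕ × ℕ → Set
MinusSol d (g , x , y) =
  2 ≤ g × 1 ≤ x × x < y × ¬ IsPerfectPower g × g ℕ.^ y ≡ d ℕ.+ g ℕ.^ x

δ : ℕ → ℕ
δ d = 1 ℕ.∸ (d ℕ.% 2)

-- For |a|, |b| ≥ 2, multiplicative dependence means |a| ^ p = |b| ^ q with p, q ≥ 1.
-- Equal powers A ^ p = B ^ q are powers of a common base (A ∣ B, and descend to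
-- B / A), so |a| = r ^ X and |b| = r ^ Y for a single r that is not a perfect power.
-- The signs of a and b and the order of X and Y then make (a, b) one of
-- (−r^x, r^y), (−r^y, r^x) for a solution of r^y + r^x = d, (r^x, r^y), (−r^y, −r^x)
-- for a solution of r^y − r^x = d, or (−d/2, d/2) when X = Y. The pairs with
-- |a| = 1 or |b| = 1 are (1, d+1), (−1, d−1), (1−d, 1), (−1−d, −1). The nine
-- families are injectively parametrised and told apart by the signs and sizes of
-- a and b, which gives the count.
module Submission where

open import Defs
open import Data.Nat using (ℕ; _≤_; _+_; _*_)
open import Data.Integer using (+_)
open import Data.Product using (∃-syntax; _×_)

open import Data.Nat using (zero; suc; _∸_; _^_; _<_; z≤n; s≤s; NonZero; ≢-nonZero; _≟_; _≤?_; _<?_; _%_)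
open import Data.Nat.Properties
open import Data.Nat.Divisibility using (_∣_; divides; quotient; m∣m*n; ∣-trans; *-cancelʳ-∣; ∣1⇒≡1)
open import Data.Nat.DivMod using (_/_; m/n*n≡m; m≡m%n+[m/n]*n; m*n/n≡m; m*n%n≡0)
open import Data.Nat.GCD using (gcd; gcd[m,n]∣m; gcd[m,n]∣n; gcd[m,n]≢0)
open import Data.Nat.Coprimality using (Coprime; coprime-/gcd; coprime-divisor)
open import Data.Nat.Induction using (<-wellFounded)
open import Data.Nat.ListAction using (sum)
open import Data.Nat.Tactic.RingSolver using (solve-∀)
open import Data.Integer as ℤ using (ℤ; -[1+_]; +[1+_]; 0ℤ; 1ℤ; ∣_∣)
import Data.Integer.Properties as ℤP
open import Data.Product as Product using (_,_; proj₁; proj₂)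
open import Data.Sum as Sum using (_⊎_; inj₁; inj₂; [_,_]′)
open import Data.Unit using (⊤; tt)
open import Data.List using (List; []; _∷_; length; filter; map; _++_; cartesianProduct; upTo)
open import Data.List.Properties using (length-++; length-map)
open import Data.List.Membership.Propositional using (_∈_)
open import Data.List.Membership.Propositional.Properties
  using (∈-cartesianProduct⁺; ∈-upTo⁺; ∈-filter⁻; ∈-filter⁺; ∈-++⁻; ∈-++⁺ˡ; ∈-++⁺ʳ; ∈-map⁻; ∈-map⁺)
open import Data.List.Relation.Unary.Any using (here; there)
import Data.List.Relation.Unary.All as All
open import Data.List.Relation.Unary.AllPairs using ([]; _∷_)
open import Data.List.Relation.Unary.Unique.Propositional using (Unique)
open import Data.List.Relation.Unary.Unique.Propositional.Properties
  using (filter⁺; ++⁺; cartesianProduct⁺; upTo⁺; map⁻)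
open import Function using (_∘_)
open import Function.Bundles using (_⇔_; mk⇔; Equivalence)
open import Induction.WellFounded using (Acc; acc)
open import Relation.Binary.Definitions using (tri<; tri≈; tri>)
open import Relation.Binary.PropositionalEquality
open import Relation.Nullary using (¬_; ¬?; Dec; yes; no; contradiction; _×-dec_)
open import Relation.Nullary.Decidable using (map′)

open Equivalence using (to; from)

m≤m^n : ∀ m {n} → 1 ≤ n → m ≤ m ^ n
m≤m^n zero          _ = z≤n
m≤m^n m@(suc _) {suc n} _ = m≤m*n m (m ^ n) {{m^n≢0 m n}}

2≤m^n : ∀ {m n} → 2 ≤ m → 1 ≤ n → 2 ≤ m ^ n
2≤m^n {m} 2≤m 1≤n = ≤-trans 2≤m (m≤m^n m 1≤n)

n<m^n : ∀ {m} n → 2 ≤ m → n < m ^ n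
n<m^n zero    2≤m = s≤s z≤n
n<m^n {m@(suc _)} (suc n) 2≤m = begin-strict
  suc n       ≤⟨ n<m^n n 2≤m ⟩
  m ^ n       <⟨ m<m*n (m ^ n) m {{m^n≢0 m n}} 2≤m ⟩
  m ^ n * m   ≡⟨ *-comm (m ^ n) m ⟩
  m ^ suc n   ∎
  where open ≤-Reasoning

^-cancelʳ-≤ : ∀ {m x y} → 2 ≤ m → m ^ x ≤ m ^ y → x ≤ y
^-cancelʳ-≤ {m} 2≤m le = ≮⇒≥ (λ y<x → <⇒≱ (^-monoʳ-< m 2≤m y<x) le)

^-cancelʳ-< : ∀ {m x y} → 1 ≤ m → m ^ x < m ^ y → x < y
^-cancelʳ-< {m@(suc _)} _ lt = ≰⇒> (λ y≤x → <⇒≱ lt (^-monoʳ-≤ m y≤x))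

^-injectiveʳ : ∀ {m x y} → 2 ≤ m → m ^ x ≡ m ^ y → x ≡ y
^-injectiveʳ 2≤m e = ≤-antisym (^-cancelʳ-≤ 2≤m (≤-reflexive e)) (^-cancelʳ-≤ 2≤m (≤-reflexive (sym e)))

^-distribʳ-* : ∀ m n k → (m * n) ^ k ≡ m ^ k * n ^ k
^-distribʳ-* m n zero    = refl
^-distribʳ-* m n (suc k) = begin
  m * n * (m * n) ^ k     ≡⟨ cong (m * n *_) (^-distribʳ-* m n k) ⟩
  m * n * (m ^ k * n ^ k) ≡⟨ [m*n]*[o*p]≡[m*o]*[n*p] m n (m ^ k) (n ^ k) ⟩
  m ^ suc k * n ^ suc k   ∎
  where open ≡-Reasoning

^-comm : ∀ m x y → (m ^ x) ^ y ≡ (m ^ y) ^ x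
^-comm m x y = begin
  (m ^ x) ^ y ≡⟨ ^-*-assoc m x y ⟩
  m ^ (x * y) ≡⟨ cong (m ^_) (*-comm x y) ⟩
  m ^ (y * x) ≡⟨ ^-*-assoc m y x ⟨
  (m ^ y) ^ x ∎
  where open ≡-Reasoning

1≤exponent : ∀ {m n k q} → 2 ≤ n → 1 ≤ q → m ^ k ≡ n ^ q → 1 ≤ k
1≤exponent {k = zero}  2≤n 1≤q e = contradiction (≤-trans (2≤m^n 2≤n 1≤q) (≤-reflexive (sym e))) λ { (s≤s ()) }
1≤exponent {k = suc k} _   _   _ = s≤s z≤n

-- Equal powers have a common base

coprime-∣^⇒∣1 : ∀ {m n} k → Coprime m n → m ∣ n ^ k → m ∣ 1
coprime-∣^⇒∣1 zero    _ m∣1   = m∣1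
coprime-∣^⇒∣1 (suc k) c m∣n^k = coprime-∣^⇒∣1 k c (coprime-divisor c m∣n^k)

-- m = m′ g, k = k′ g with g = gcd m k and m′, k′ coprime; then m′ ∣ k′ ^ n forces m′ = 1.
^-cancel-∣ : ∀ {m k n} → 1 ≤ m → 1 ≤ n → m ^ n ∣ k ^ n → m ∣ k
^-cancel-∣ {m@(suc _)} {k} {n@(suc n-1)} _ _ m^n∣k^n = subst (_∣ k) (sym m≡g) (gcd[m,n]∣n m k)
  where
  g = gcd m k
  instance
    g≢0 : NonZero g
    g≢0 = ≢-nonZero (gcd[m,n]≢0 m k (inj₁ λ ()))
    g^n≢0 : NonZero (g ^ n)
    g^n≢0 = m^n≢0 g n
  m≡m′g : m ≡ m / g * g
  m≡m′g = sym (m/n*n≡m (gcd[m,n]∣m m k))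
  k≡k′g : k ≡ k / g * g
  k≡k′g = sym (m/n*n≡m (gcd[m,n]∣n m k))
  m′^n∣k′^n : (m / g) ^ n ∣ (k / g) ^ n
  m′^n∣k′^n = *-cancelʳ-∣ (g ^ n) (subst₂ _∣_
    (trans (cong (_^ n) m≡m′g) (^-distribʳ-* (m / g) g n))
    (trans (cong (_^ n) k≡k′g) (^-distribʳ-* (k / g) g n)) m^n∣k^n)
  m′≡1 : m / g ≡ 1
  m′≡1 = ∣1⇒≡1 (coprime-∣^⇒∣1 n (coprime-/gcd m k) (∣-trans (m∣m*n ((m / g) ^ n-1)) m′^n∣k′^n))
  m≡g : m ≡ g
  m≡g = trans m≡m′g (trans (cong (_* g) m′≡1) (*-identityˡ g))

^≡^⇒factor : ∀ {A B p q} → 2 ≤ A → 1 ≤ q → A ≤ B → A ^ p ≡ B ^ q →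
  ∃[ B′ ] (B ≡ B′ * A × A ^ (p ∸ q) ≡ B′ ^ q)
^≡^⇒factor {A@(suc _)} {B} {p} {q} 2≤A 1≤q A≤B e = B′ , B≡B′A , *-cancelˡ-≡ _ _ (A ^ q) {{m^n≢0 A q}} (begin
    A ^ q * A ^ (p ∸ q) ≡⟨ ^-distribˡ-+-* A q (p ∸ q) ⟨
    A ^ (q + (p ∸ q))   ≡⟨ cong (A ^_) (m+[n∸m]≡n q≤p) ⟩
    A ^ p               ≡⟨ e ⟩
    B ^ q               ≡⟨ cong (_^ q) B≡B′A ⟩
    (B′ * A) ^ q        ≡⟨ ^-distribʳ-* B′ A q ⟩
    B′ ^ q * A ^ q      ≡⟨ *-comm (B′ ^ q) (A ^ q) ⟩
    A ^ q * B′ ^ q      ∎)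
  where
  open ≡-Reasoning
  q≤p : q ≤ p
  q≤p = ^-cancelʳ-≤ 2≤A (≤-trans (^-monoˡ-≤ q A≤B) (≤-reflexive (sym e)))
  A∣B : A ∣ B
  A∣B = ^-cancel-∣ (s≤s z≤n) 1≤q (divides (A ^ (p ∸ q)) (begin
    B ^ q               ≡⟨ e ⟨
    A ^ p               ≡⟨ cong (A ^_) (m+[n∸m]≡n q≤p) ⟨
    A ^ (q + (p ∸ q))   ≡⟨ ^-distribˡ-+-* A q (p ∸ q) ⟩
    A ^ q * A ^ (p ∸ q) ≡⟨ *-comm (A ^ q) _ ⟩
    A ^ (p ∸ q) * A ^ q ∎))
  B′ = quotient A∣B
  B≡B′A : B ≡ B′ * A
  B≡B′A = _∣_.equality A∣B

CommonBase : ℕ → ℕ → Set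
CommonBase A B = ∃[ C ] ∃[ x ] ∃[ y ] (1 ≤ x × 1 ≤ y × A ≡ C ^ x × B ≡ C ^ y)

commonBase-sym : ∀ {A B} → CommonBase A B → CommonBase B A
commonBase-sym (C , x , y , 1≤x , 1≤y , A≡C^x , B≡C^y) = C , y , x , 1≤y , 1≤x , B≡C^y , A≡C^x

commonBase-*ʳ : ∀ {A B} → CommonBase A B → CommonBase A (B * A)
commonBase-*ʳ (C , x , y , 1≤x , 1≤y , A≡C^x , B≡C^y) =
  C , x , y + x , 1≤x , ≤-trans 1≤y (m≤m+n y x) , A≡C^x ,
  trans (cong₂ _*_ B≡C^y A≡C^x) (sym (^-distribˡ-+-* C y x))

commonBase-≤ : ∀ {A B p q} → Acc _<_ B → 2 ≤ A → 2 ≤ B → 1 ≤ q → A ≤ B → A ^ p ≡ B ^ q → CommonBase A B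
commonBase-≤ {A} {B} {p} {q} (acc rs) 2≤A 2≤B 1≤q A≤B e with ^≡^⇒factor 2≤A 1≤q A≤B e
... | zero , B≡0 , _ = contradiction (≤-trans 2≤B (≤-reflexive B≡0)) λ ()
... | suc zero , B≡1*A , _ =
  A , 1 , 1 , ≤-refl , ≤-refl , sym (*-identityʳ A) , trans B≡1*A (trans (*-identityˡ A) (sym (*-identityʳ A)))
... | B′@(suc (suc _)) , B≡B′A , e′ = subst (CommonBase A) (sym B≡B′A) (commonBase-*ʳ A~B′)
  where
  A≢0 : NonZero A
  A≢0 = ≢-nonZero λ { refl → contradiction 2≤A λ () }
  B′<B : B′ < B
  B′<B = <-≤-trans (m<m*n B′ A 2≤A) (≤-reflexive (sym B≡B′A))
  A<B : A < B
  A<B = <-≤-trans (m<m*n A B′ {{A≢0}} (s≤s (s≤s z≤n))) (≤-reflexive (trans (*-comm A B′) (sym B≡B′A)))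
  1≤p∸q : 1 ≤ p ∸ q
  1≤p∸q = 1≤exponent (s≤s (s≤s z≤n)) 1≤q e′
  A~B′ : CommonBase A B′
  A~B′ with ≤-total A B′
  ... | inj₁ A≤B′ = commonBase-≤ {p = p ∸ q} (rs B′<B) 2≤A (s≤s (s≤s z≤n)) 1≤q A≤B′ e′
  ... | inj₂ B′≤A = commonBase-sym (commonBase-≤ {p = q} (rs A<B) (s≤s (s≤s z≤n)) 2≤A 1≤p∸q B′≤A (sym e′))

^≡^⇒commonBase : ∀ {A B p q} → 2 ≤ A → 2 ≤ B → 1 ≤ p → 1 ≤ q → A ^ p ≡ B ^ q → CommonBase A B
^≡^⇒commonBase {A} {B} {p} {q} 2≤A 2≤B 1≤p 1≤q e with ≤-total A B
... | inj₁ A≤B = commonBase-≤ {p = p} (<-wellFounded B) 2≤A 2≤B 1≤q A≤B e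
... | inj₂ B≤A = commonBase-sym (commonBase-≤ {p = q} (<-wellFounded A) 2≤B 2≤A 1≤p B≤A (sym e))

Primitive : ℕ → Set
Primitive g = 2 ≤ g × ¬ IsPerfectPower g

2≤base : ∀ {n m k} → 2 ≤ n → 1 ≤ k → n ≡ m ^ k → 2 ≤ m
2≤base {m = zero}        {suc k} 2≤n _ n≡0 = contradiction (≤-trans 2≤n (≤-reflexive n≡0)) λ ()
2≤base {m = suc zero}    {k}     2≤n _ n≡1 = contradiction (≤-trans 2≤n (≤-reflexive (trans n≡1 (^-zeroˡ k)))) λ { (s≤s ()) }
2≤base {m = suc (suc m)}         _   _ _   = s≤s (s≤s z≤n)

-- g = m ^ k with m ≥ 2 forces m ≤ g and k < g, so the search is bounded; 0 and 1 are squares.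
perfectPower? : ∀ g → Dec (IsPerfectPower g)
perfectPower? g = map′ fromBounded toBounded
  (anyUpTo? (λ m → anyUpTo? (λ k → (2 ≤? k) ×-dec (g ≟ m ^ k)) (3 + g)) (suc g))
  where
  Bounded = ∃[ m ] (m < suc g × ∃[ k ] (k < 3 + g × (2 ≤ k × g ≡ m ^ k)))
  fromBounded : Bounded → IsPerfectPower g
  fromBounded (m , _ , k , _ , 2≤k , g≡m^k) = m , k , 2≤k , g≡m^k
  toBounded : IsPerfectPower g → Bounded
  toBounded (zero , suc (suc k) , _ , g≡0) = 0 , s≤s z≤n , 2 , s≤s (s≤s (s≤s z≤n)) , ≤-refl , g≡0
  toBounded (zero , suc zero , s≤s () , _)
  toBounded (suc zero , k , _ , g≡1^k) = 1 , s≤s (≤-reflexive (sym g≡1)) , 2 , s≤s (s≤s (s≤s z≤n)) , ≤-refl , g≡1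
    where g≡1 = trans g≡1^k (^-zeroˡ k)
  toBounded (m@(suc (suc _)) , k , 2≤k , g≡m^k) =
    m , s≤s (≤-trans (m≤m^n m (≤-trans (s≤s z≤n) 2≤k)) (≤-reflexive (sym g≡m^k))) ,
    k , ≤-trans (<-≤-trans (n<m^n k (s≤s (s≤s z≤n))) (≤-reflexive (sym g≡m^k))) (m≤n+m g 3) , 2≤k , g≡m^k

primitiveRoot-acc : ∀ {n} → Acc _<_ n → 2 ≤ n → ∃[ r ] ∃[ s ] (Primitive r × 1 ≤ s × n ≡ r ^ s)
primitiveRoot-acc {n} (acc rs) 2≤n with perfectPower? n
... | no ¬pp = n , 1 , (2≤n , ¬pp) , ≤-refl , sym (*-identityʳ n)
... | yes (m , k , 2≤k , n≡m^k) with primitiveRoot-acc (rs m<n) 2≤m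
  where
  2≤m = 2≤base 2≤n (≤-trans (s≤s z≤n) 2≤k) n≡m^k
  m<n = <-≤-trans (subst (_< m ^ k) (*-identityʳ m) (^-monoʳ-< m 2≤m 2≤k)) (≤-reflexive (sym n≡m^k))
...   | r , s , prim , 1≤s , m≡r^s =
  r , s * k , prim , *-mono-≤ 1≤s (≤-trans (s≤s z≤n) 2≤k) , trans n≡m^k (trans (cong (_^ k) m≡r^s) (^-*-assoc r s k))

primitiveRoot : ∀ {n} → 2 ≤ n → ∃[ r ] ∃[ s ] (Primitive r × 1 ≤ s × n ≡ r ^ s)
primitiveRoot {n} = primitiveRoot-acc (<-wellFounded n)

¬perfectPower⇒≡base : ∀ {g C u} → ¬ IsPerfectPower g → 1 ≤ u → g ≡ C ^ u → g ≡ C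
¬perfectPower⇒≡base {C = C} {suc zero}    _   _ g≡C^1 = trans g≡C^1 (*-identityʳ C)
¬perfectPower⇒≡base {C = C} {suc (suc u)} ¬pp _ g≡C^u = contradiction (C , suc (suc u) , s≤s (s≤s z≤n) , g≡C^u) ¬pp

primitive-unique : ∀ {g g′ x x′} → Primitive g → Primitive g′ → 1 ≤ x → 1 ≤ x′ → g ^ x ≡ g′ ^ x′ → g ≡ g′
primitive-unique (2≤g , ¬pp) (2≤g′ , ¬pp′) 1≤x 1≤x′ e
  with C , u , v , 1≤u , 1≤v , g≡C^u , g′≡C^v ← ^≡^⇒commonBase 2≤g 2≤g′ 1≤x 1≤x′ e
  = trans (¬perfectPower⇒≡base ¬pp 1≤u g≡C^u) (sym (¬perfectPower⇒≡base ¬pp′ 1≤v g′≡C^v))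

primitivePowers-injective : ∀ {g g′ x x′ y y′} → Primitive g → Primitive g′ → 1 ≤ x → 1 ≤ x′ →
  g ^ x ≡ g′ ^ x′ → g ^ y ≡ g′ ^ y′ → (g , x , y) ≡ (g′ , x′ , y′)
primitivePowers-injective {g} prim prim′ 1≤x 1≤x′ e₁ e₂ with primitive-unique prim prim′ 1≤x 1≤x′ e₁
... | refl = cong₂ (λ x y → g , x , y) (^-injectiveʳ (proj₁ prim) e₁) (^-injectiveʳ (proj₁ prim) e₂)

^≡^⇒samePrimitiveRoot : ∀ {A B p q r r′ X Y} → 1 ≤ p → 1 ≤ q → A ^ p ≡ B ^ q →
  Primitive r → Primitive r′ → 1 ≤ X → 1 ≤ Y → A ≡ r ^ X → B ≡ r′ ^ Y → r ≡ r′
^≡^⇒samePrimitiveRoot {A} {B} {p} {q} {r} {r′} {X} {Y} 1≤p 1≤q A^p≡B^q prim prim′ 1≤X 1≤Y A≡r^X B≡r′^Y =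
  primitive-unique prim prim′ (*-mono-≤ 1≤X 1≤p) (*-mono-≤ 1≤Y 1≤q) (begin
    r ^ (X * p)      ≡⟨ ^-*-assoc r X p ⟨
    (r ^ X) ^ p      ≡⟨ cong (_^ p) A≡r^X ⟨
    A ^ p            ≡⟨ A^p≡B^q ⟩
    B ^ q            ≡⟨ cong (_^ q) B≡r′^Y ⟩
    (r′ ^ Y) ^ q     ≡⟨ ^-*-assoc r′ Y q ⟩
    r′ ^ (Y * q)     ∎)
  where open ≡-Reasoning

-- Multiplicative dependence

neg : ℕ → ℤ
neg n = ℤ.- (+ n)

posPart-neg : ∀ n → posPart (neg n) ≡ 0
posPart-neg zero    = refl
posPart-neg (suc n) = refl

negPart-neg : ∀ n → negPart (neg n) ≡ n
negPart-neg zero    = refl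
negPart-neg (suc n) = refl

∣i^n∣≡∣i∣^n : ∀ i n → ∣ i ℤ.^ n ∣ ≡ ∣ i ∣ ^ n
∣i^n∣≡∣i∣^n i zero    = refl
∣i^n∣≡∣i∣^n i (suc n) = trans (ℤP.abs-* i (i ℤ.^ n)) (cong (∣ i ∣ *_) (∣i^n∣≡∣i∣^n i n))

i^2≡+∣i∣^2 : ∀ i → i ℤ.^ 2 ≡ + (∣ i ∣ ^ 2)
i^2≡+∣i∣^2 (+ zero)  = refl
i^2≡+∣i∣^2 +[1+ n ]  = refl
i^2≡+∣i∣^2 -[1+ n ]  = refl

i^[n*2]≡+∣i∣^[n*2] : ∀ i n → i ℤ.^ (n * 2) ≡ + (∣ i ∣ ^ (n * 2))
i^[n*2]≡+∣i∣^[n*2] i n = begin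
  i ℤ.^ (n * 2)          ≡⟨ ℤP.^-*-assoc i n 2 ⟨
  (i ℤ.^ n) ℤ.^ 2        ≡⟨ i^2≡+∣i∣^2 (i ℤ.^ n) ⟩
  + (∣ i ℤ.^ n ∣ ^ 2)    ≡⟨ cong (λ m → + (m ^ 2)) (∣i^n∣≡∣i∣^n i n) ⟩
  + ((∣ i ∣ ^ n) ^ 2)    ≡⟨ cong +_ (^-*-assoc ∣ i ∣ n 2) ⟩
  + (∣ i ∣ ^ (n * 2))    ∎
  where open ≡-Reasoning

i*j≢0 : ∀ {i j} → ¬ i ≡ 0ℤ → ¬ j ≡ 0ℤ → ¬ i ℤ.* j ≡ 0ℤ
i*j≢0 {i} i≢0 j≢0 ij≡0 = [ i≢0 , j≢0 ]′ (ℤP.i*j≡0⇒i≡0∨j≡0 i ij≡0)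

-- Even exponents make the signs of a and b irrelevant.
^≡^⇒multDep : ∀ {a b p q} → ¬ a ≡ 0ℤ → ¬ b ≡ 0ℤ → ¬ (p ≡ 0 × q ≡ 0) → ∣ a ∣ ^ p ≡ ∣ b ∣ ^ q → MultDep a b
^≡^⇒multDep {a} {b} {p} {q} a≢0 b≢0 pq≢0 e = i*j≢0 a≢0 b≢0 , + (p * 2) , neg (q * 2) , k≢0 , dependence
  where
  k≢0 : ¬ (+ (p * 2) ≡ 0ℤ × neg (q * 2) ≡ 0ℤ)
  k≢0 (p*2≡0 , -q*2≡0) = pq≢0 (m*n≡0⇒m≡0 p 2 (ℤP.+-injective p*2≡0) ,
                               m*n≡0⇒m≡0 q 2 (ℤP.+-injective (ℤP.neg-injective -q*2≡0)))
  dependence : a ℤ.^ (p * 2) ℤ.* b ℤ.^ posPart (neg (q * 2)) ≡ a ℤ.^ 0 ℤ.* b ℤ.^ negPart (neg (q * 2))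
  dependence rewrite posPart-neg (q * 2) | negPart-neg (q * 2) = begin
    a ℤ.^ (p * 2) ℤ.* 1ℤ       ≡⟨ ℤP.*-identityʳ _ ⟩
    a ℤ.^ (p * 2)              ≡⟨ i^[n*2]≡+∣i∣^[n*2] a p ⟩
    + (∣ a ∣ ^ (p * 2))        ≡⟨ cong +_ (^-*-assoc ∣ a ∣ p 2) ⟨
    + ((∣ a ∣ ^ p) ^ 2)        ≡⟨ cong (λ m → + (m ^ 2)) e ⟩
    + ((∣ b ∣ ^ q) ^ 2)        ≡⟨ cong +_ (^-*-assoc ∣ b ∣ q 2) ⟩
    + (∣ b ∣ ^ (q * 2))        ≡⟨ i^[n*2]≡+∣i∣^[n*2] b q ⟨
    b ℤ.^ (q * 2)              ≡⟨ ℤP.*-identityˡ _ ⟨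
    1ℤ ℤ.* b ℤ.^ (q * 2)       ∎
    where open ≡-Reasoning

^≡1⇒exponent≡0 : ∀ {m n} → 2 ≤ m → m ^ n ≡ 1 → n ≡ 0
^≡1⇒exponent≡0 {m} {n} 2≤m e with m^n≡1⇒n≡0∨m≡1 m n e
... | inj₁ n≡0 = n≡0
... | inj₂ refl = contradiction 2≤m λ { (s≤s ()) }

exponentsOfDependence : ∀ {A B} → 2 ≤ A → 2 ≤ B → ∀ k₁ k₂ → ¬ (k₁ ≡ 0ℤ × k₂ ≡ 0ℤ) →
  A ^ posPart k₁ * B ^ posPart k₂ ≡ A ^ negPart k₁ * B ^ negPart k₂ →
  ∃[ p ] ∃[ q ] (1 ≤ p × 1 ≤ q × A ^ p ≡ B ^ q)
exponentsOfDependence {A} {B} 2≤A 2≤B (+ p₁) (+ p₂) k≢0 e = contradiction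
  (cong +_ (^≡1⇒exponent≡0 2≤A (m*n≡1⇒m≡1 (A ^ p₁) (B ^ p₂) e)) ,
   cong +_ (^≡1⇒exponent≡0 2≤B (m*n≡1⇒n≡1 (A ^ p₁) (B ^ p₂) e))) k≢0
exponentsOfDependence {A} {B} 2≤A 2≤B (+ p₁) -[1+ n₂ ] _ e =
  p₁ , suc n₂ , 1≤exponent {k = p₁} {q = suc n₂} 2≤B (s≤s z≤n) A^p₁≡B^n , s≤s z≤n , A^p₁≡B^n
  where
  A^p₁≡B^n : A ^ p₁ ≡ B ^ suc n₂
  A^p₁≡B^n = trans (sym (*-identityʳ (A ^ p₁))) (trans e (*-identityˡ (B ^ suc n₂)))
exponentsOfDependence {A} {B} 2≤A 2≤B -[1+ n₁ ] (+ p₂) _ e =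
  suc n₁ , p₂ , s≤s z≤n , 1≤exponent {k = p₂} {q = suc n₁} 2≤A (s≤s z≤n) (sym A^n≡B^p₂) , A^n≡B^p₂
  where
  A^n≡B^p₂ : A ^ suc n₁ ≡ B ^ p₂
  A^n≡B^p₂ = trans (sym (*-identityʳ (A ^ suc n₁))) (trans (sym e) (*-identityˡ (B ^ p₂)))
exponentsOfDependence {A} {B} 2≤A 2≤B -[1+ n₁ ] -[1+ n₂ ] _ e =
  contradiction (^≡1⇒exponent≡0 {n = suc n₁} 2≤A (m*n≡1⇒m≡1 (A ^ suc n₁) (B ^ suc n₂) (sym e))) λ ()

multDep⇒^≡^ : ∀ {a b} → 2 ≤ ∣ a ∣ → 2 ≤ ∣ b ∣ → MultDep a b → ∃[ p ] ∃[ q ] (1 ≤ p × 1 ≤ q × ∣ a ∣ ^ p ≡ ∣ b ∣ ^ q)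
multDep⇒^≡^ {a} {b} 2≤∣a∣ 2≤∣b∣ (_ , k₁ , k₂ , k≢0 , e) = exponentsOfDependence 2≤∣a∣ 2≤∣b∣ k₁ k₂ k≢0 (begin
  ∣ a ∣ ^ posPart k₁ * ∣ b ∣ ^ posPart k₂    ≡⟨ ∣i^m*j^n∣ (posPart k₁) (posPart k₂) ⟨
  ∣ a ℤ.^ posPart k₁ ℤ.* b ℤ.^ posPart k₂ ∣ ≡⟨ cong ∣_∣ e ⟩
  ∣ a ℤ.^ negPart k₁ ℤ.* b ℤ.^ negPart k₂ ∣ ≡⟨ ∣i^m*j^n∣ (negPart k₁) (negPart k₂) ⟩
  ∣ a ∣ ^ negPart k₁ * ∣ b ∣ ^ negPart k₂    ∎)
  where
  open ≡-Reasoning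
  ∣i^m*j^n∣ : ∀ m n → ∣ a ℤ.^ m ℤ.* b ℤ.^ n ∣ ≡ ∣ a ∣ ^ m * ∣ b ∣ ^ n
  ∣i^m*j^n∣ m n = trans (ℤP.abs-* (a ℤ.^ m) (b ℤ.^ n)) (cong₂ _*_ (∣i^n∣≡∣i∣^n a m) (∣i^n∣≡∣i∣^n b n))

HasCard-cong : ∀ {A : Set} {P Q : A → Set} {n} → (∀ x → P x ⇔ Q x) → HasCard P n → HasCard Q n
HasCard-cong P⇔Q (xs , unique , len , mem) =
  xs , unique , len , λ x → mk⇔ (to (P⇔Q x) ∘ to (mem x)) (from (mem x) ∘ from (P⇔Q x))

HasCard-filter : ∀ {A : Set} {P : A → Set} (P? : ∀ x → Dec (P x)) {xs : List A} →
  Unique xs → (∀ x → P x → x ∈ xs) → HasCard P (length (filter P? xs))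
HasCard-filter P? {xs} unique complete =
  filter P? xs , filter⁺ P? unique , refl ,
  λ x → mk⇔ (proj₂ ∘ ∈-filter⁻ P? {xs = xs}) (λ px → ∈-filter⁺ P? (complete x px) px)

HasCard-∪ : ∀ {A : Set} {P Q : A → Set} {m n} → HasCard P m → HasCard Q n →
  (∀ x → P x → ¬ Q x) → HasCard (λ x → P x ⊎ Q x) (m + n)
HasCard-∪ {P = P} {Q} (xs , uxs , lxs , mxs) (ys , uys , lys , mys) disjoint =
  xs ++ ys , ++⁺ uxs uys (λ (x∈xs , x∈ys) → disjoint _ (to (mxs _) x∈xs) (to (mys _) x∈ys)) ,
  trans (length-++ xs) (cong₂ _+_ lxs lys) , mem
  where
  mem : ∀ x → (x ∈ xs ++ ys) ⇔ (P x ⊎ Q x)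
  mem x = mk⇔ (Sum.map (to (mxs x)) (to (mys x)) ∘ ∈-++⁻ xs)
              [ ∈-++⁺ˡ ∘ from (mxs x) , ∈-++⁺ʳ xs ∘ from (mys x) ]′

HasCard-partition : ∀ {A K : Set} {P : A → Set} (κ : A → K) {ks : List K} → Unique ks → (∀ k → k ∈ ks) →
  {c : K → ℕ} → (∀ k → HasCard (λ x → P x × κ x ≡ k) (c k)) → HasCard P (sum (map c ks))
HasCard-partition {A} {K} {P} κ {ks} unique complete {c} card =
  HasCard-cong (λ x → mk⇔ proj₁ (λ px → px , complete (κ x))) (P∩κ⁻¹ ks unique)
  where
  P∩κ⁻¹ : ∀ ks → Unique ks → HasCard (λ x → P x × κ x ∈ ks) (sum (map c ks))
  P∩κ⁻¹ []       _ = [] , [] , refl , λ x → mk⇔ (λ ()) (λ ())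
  P∩κ⁻¹ (k ∷ ks) (k∉ks ∷ unique) = HasCard-cong split
    (HasCard-∪ (card k) (P∩κ⁻¹ ks unique) λ x (_ , κx≡k) (_ , κx∈ks) → All.lookup k∉ks κx∈ks (sym κx≡k))
    where
    split : ∀ x → ((P x × κ x ≡ k) ⊎ (P x × κ x ∈ ks)) ⇔ (P x × κ x ∈ k ∷ ks)
    split x = mk⇔ [ Product.map₂ here , Product.map₂ there ]′
      λ { (px , here κx≡k) → inj₁ (px , κx≡k) ; (px , there κx∈ks) → inj₂ (px , κx∈ks) }

HasCard-image : ∀ {A B : Set} {V : A → Set} {n} (f : A → B) → HasCard V n →
  (∀ {t t′} → V t → V t′ → f t ≡ f t′ → t ≡ t′) → HasCard (λ z → ∃[ t ] (V t × f t ≡ z)) n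
HasCard-image {V = V} f (ts , unique , len , mem) injective =
  map f ts , map-unique unique (to (mem _)) , trans (length-map f ts) len , image
  where
  map-unique : ∀ {ts} → Unique ts → (∀ {t} → t ∈ ts → V t) → Unique (map f ts)
  map-unique {[]}     []              _     = []
  map-unique {t ∷ ts} (t∉ts ∷ unique) valid = All.tabulate ft∉fts ∷ map-unique unique (valid ∘ there)
    where
    ft∉fts : ∀ {z} → z ∈ map f ts → f t ≢ z
    ft∉fts z∈fts ft≡z with t′ , t′∈ts , refl ← ∈-map⁻ f z∈fts =
      All.lookup t∉ts t′∈ts (injective (valid (here refl)) (valid (there t′∈ts)) ft≡z)
  image : ∀ z → (z ∈ map f ts) ⇔ (∃[ t ] (V t × f t ≡ z))
  image z = mk⇔ (λ z∈ → let t , t∈ts , z≡ft = ∈-map⁻ f z∈ in t , to (mem t) t∈ts , sym z≡ft)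
                (λ { (t , vt , refl) → ∈-map⁺ f (from (mem t) vt) })

HasCard-⊤ : HasCard {⊤} (λ _ → ⊤) 1
HasCard-⊤ = tt ∷ [] , All.[] ∷ [] , refl , λ { tt → mk⇔ (λ _ → tt) (λ _ → here refl) }

HasCard-≡0 : ∀ n → HasCard {⊤} (λ _ → n ≡ 0) (1 ∸ n)
HasCard-≡0 zero    = tt ∷ [] , All.[] ∷ [] , refl , λ { tt → mk⇔ (λ _ → refl) (λ _ → here refl) }
HasCard-≡0 (suc n) = [] , [] , sym (0∸n≡0 n) , λ { tt → mk⇔ (λ ()) (λ ()) }

-- Finiteness of the solution sets

triples : ℕ → List (ℕ × ℕ × ℕ)
triples N = cartesianProduct (upTo (suc N)) (cartesianProduct (upTo (suc N)) (upTo (suc N)))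

triples-unique : ∀ N → Unique (triples N)
triples-unique N = cartesianProduct⁺ (upTo⁺ (suc N)) (cartesianProduct⁺ (upTo⁺ (suc N)) (upTo⁺ (suc N)))

∈-triples : ∀ {N g x y} → 2 ≤ g → x < y → g ^ y ≤ N → (g , x , y) ∈ triples N
∈-triples {N} {g} {x} {y} 2≤g x<y g^y≤N =
  ∈-cartesianProduct⁺ (∈-upTo⁺ (s≤s g≤N)) (∈-cartesianProduct⁺ (∈-upTo⁺ (s≤s (<⇒≤ (<-≤-trans x<y y≤N)))) (∈-upTo⁺ (s≤s y≤N)))
  where
  g≤N = ≤-trans (m≤m^n g (≤-trans (s≤s z≤n) x<y)) g^y≤N
  y≤N = <⇒≤ (<-≤-trans (n<m^n y 2≤g) g^y≤N)

plusSol? : ∀ d t → Dec (PlusSol d t)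
plusSol? d (g , x , y) = (2 ≤? g) ×-dec ((1 ≤? x) ×-dec ((x <? y) ×-dec (¬? (perfectPower? g) ×-dec (g ^ y + g ^ x ≟ d))))

minusSol? : ∀ d t → Dec (MinusSol d t)
minusSol? d (g , x , y) = (2 ≤? g) ×-dec ((1 ≤? x) ×-dec ((x <? y) ×-dec (¬? (perfectPower? g) ×-dec (g ^ y ≟ d + g ^ x))))

-- g ^ y ≥ 2 g ^ x, so d = g ^ y - g ^ x ≥ g ^ x.
minusSol-bounded : ∀ {d g x y} → MinusSol d (g , x , y) → g ^ y ≤ d + d
minusSol-bounded {d} {g} {x} {y} (2≤g , _ , x<y , _ , g^y≡d+g^x) = begin
  g ^ y     ≡⟨ g^y≡d+g^x ⟩
  d + g ^ x ≤⟨ +-monoʳ-≤ d g^x≤d ⟩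
  d + d     ∎
  where
  open ≤-Reasoning
  g^x+g^x≤d+g^x : g ^ x + g ^ x ≤ d + g ^ x
  g^x+g^x≤d+g^x = begin
    g ^ x + g ^ x       ≡⟨ cong (_+_ (g ^ x)) (+-identityʳ (g ^ x)) ⟨
    2 * g ^ x           ≤⟨ *-monoˡ-≤ (g ^ x) 2≤g ⟩
    g ^ suc x           ≤⟨ ^-monoʳ-≤ g {{≢-nonZero λ { refl → contradiction 2≤g λ () }}} x<y ⟩
    g ^ y               ≡⟨ g^y≡d+g^x ⟩
    d + g ^ x           ∎
  g^x≤d : g ^ x ≤ d
  g^x≤d = +-cancelʳ-≤ (g ^ x) (g ^ x) d g^x+g^x≤d+g^x

plusSol-finite : ∀ d → ∃[ n ] HasCard (PlusSol d) n
plusSol-finite d = _ , HasCard-filter (plusSol? d) (triples-unique d)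
  λ { (g , x , y) (2≤g , _ , x<y , _ , g^y+g^x≡d) → ∈-triples 2≤g x<y (≤-trans (m≤m+n (g ^ y) (g ^ x)) (≤-reflexive g^y+g^x≡d)) }

minusSol-finite : ∀ d → ∃[ n ] HasCard (MinusSol d) n
minusSol-finite d = _ , HasCard-filter (minusSol? d) (triples-unique (d + d))
  λ { (g , x , y) sol@(2≤g , _ , x<y , _ , _) → ∈-triples 2≤g x<y (minusSol-bounded sol) }

[+m]-[-n]≡+[m+n] : ∀ m n → + m ℤ.- neg n ≡ + (m + n)
[+m]-[-n]≡+[m+n] m n = cong (ℤ._+_ (+ m)) (ℤP.neg-involutive (+ n))

[+m]-[+n]≡+k⇔m≡k+n : ∀ {m n k} → (+ m ℤ.- + n ≡ + k) ⇔ (m ≡ k + n)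
[+m]-[+n]≡+k⇔m≡k+n {m} {n} {k} = mk⇔ to′ from′
  where
  to′ : + m ℤ.- + n ≡ + k → m ≡ k + n
  to′ e = ℤP.+-injective (begin
    + m                       ≡⟨ ℤP.+-identityʳ (+ m) ⟨
    + m ℤ.+ 0ℤ                ≡⟨ cong (ℤ._+_ (+ m)) (ℤP.+-inverseˡ (+ n)) ⟨
    + m ℤ.+ (neg n ℤ.+ + n)   ≡⟨ ℤP.+-assoc (+ m) (neg n) (+ n) ⟨
    + m ℤ.- + n ℤ.+ + n       ≡⟨ cong (λ i → i ℤ.+ + n) e ⟩
    + (k + n)                 ∎)
    where open ≡-Reasoning
  from′ : m ≡ k + n → + m ℤ.- + n ≡ + k
  from′ refl = trans (ℤP.[+m]-[+n]≡m⊖n (k + n) n) (trans (ℤP.⊖-≥ (m≤n+m n k)) (cong +_ (m+n∸n≡m k n)))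

[-m]-[-n]≡+k⇔n≡k+m : ∀ {m n k} → (neg m ℤ.- neg n ≡ + k) ⇔ (n ≡ k + m)
[-m]-[-n]≡+k⇔n≡k+m {m} {n} {k} =
  mk⇔ (to [+m]-[+n]≡+k⇔m≡k+n ∘ trans (sym swap)) (trans swap ∘ from [+m]-[+n]≡+k⇔m≡k+n)
  where
  swap : neg m ℤ.- neg n ≡ + n ℤ.- + m
  swap = trans (cong (ℤ._+_ (neg m)) (ℤP.neg-involutive (+ n))) (ℤP.+-comm (neg m) (+ n))

-- The nine kinds of pairs in 𝓜(d)

data Kind : Set where
  sumAsc sumDesc diffPos diffNeg : Kind
  leftOne leftMinusOne rightOne rightMinusOne : Kind
  opposite : Kind

allKinds : List Kind
allKinds = sumAsc ∷ sumDesc ∷ diffPos ∷ diffNeg ∷ leftOne ∷ leftMinusOne ∷ rightOne ∷ rightMinusOne ∷ opposite ∷ []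

kindIndex : Kind → ℕ
kindIndex sumAsc        = 0
kindIndex sumDesc       = 1
kindIndex diffPos       = 2
kindIndex diffNeg       = 3
kindIndex leftOne       = 4
kindIndex leftMinusOne  = 5
kindIndex rightOne      = 6
kindIndex rightMinusOne = 7
kindIndex opposite      = 8

allKinds-unique : Unique allKinds
allKinds-unique = map⁻ {f = kindIndex} (upTo⁺ 9)

∈-allKinds : ∀ k → k ∈ allKinds
∈-allKinds sumAsc        = here refl
∈-allKinds sumDesc       = there (here refl)
∈-allKinds diffPos       = there (there (here refl))
∈-allKinds diffNeg       = there (there (there (here refl)))
∈-allKinds leftOne       = there (there (there (there (here refl))))
∈-allKinds leftMinusOne  = there (there (there (there (there (here refl)))))
∈-allKinds rightOne      = there (there (there (there (there (there (here refl))))))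
∈-allKinds rightMinusOne = there (there (there (there (there (there (there (here refl)))))))
∈-allKinds opposite      = there (there (there (there (there (there (there (there (here refl))))))))

Parameter : Kind → Set
Parameter sumAsc  = ℕ × ℕ × ℕ
Parameter sumDesc = ℕ × ℕ × ℕ
Parameter diffPos = ℕ × ℕ × ℕ
Parameter diffNeg = ℕ × ℕ × ℕ
Parameter _       = ⊤

Valid : ℕ → (k : Kind) → Parameter k → Set
Valid d sumAsc        = PlusSol d
Valid d sumDesc       = PlusSol d
Valid d diffPos       = MinusSol d
Valid d diffNeg       = MinusSol d
Valid d leftOne       = λ _ → ⊤
Valid d leftMinusOne  = λ _ → ⊤
Valid d rightOne      = λ _ → ⊤
Valid d rightMinusOne = λ _ → ⊤
Valid d opposite      = λ _ → d % 2 ≡ 0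

pair : ℕ → (k : Kind) → Parameter k → ℤ × ℤ
pair d sumAsc  (g , x , y) = neg (g ^ x) , + (g ^ y)
pair d sumDesc (g , x , y) = neg (g ^ y) , + (g ^ x)
pair d diffPos (g , x , y) = + (g ^ x)   , + (g ^ y)
pair d diffNeg (g , x , y) = neg (g ^ y) , neg (g ^ x)
pair d leftOne       _ = + 1         , + suc d
pair d leftMinusOne  _ = neg 1       , + (d ∸ 1)
pair d rightOne      _ = neg (d ∸ 1) , + 1
pair d rightMinusOne _ = neg (suc d) , neg 1
pair d opposite      _ = neg (d / 2) , + (d / 2)

multiplicity : ℕ → ℕ → ℕ → Kind → ℕ
multiplicity np nm d sumAsc   = np
multiplicity np nm d sumDesc  = np
multiplicity np nm d diffPos  = nm
multiplicity np nm d diffNeg  = nm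
multiplicity np nm d opposite = δ d
multiplicity np nm d _        = 1

HasCard-Valid : ∀ {d np nm} → HasCard (PlusSol d) np → HasCard (MinusSol d) nm →
  ∀ k → HasCard (Valid d k) (multiplicity np nm d k)
HasCard-Valid plus minus sumAsc        = plus
HasCard-Valid plus minus sumDesc       = plus
HasCard-Valid plus minus diffPos       = minus
HasCard-Valid plus minus diffNeg       = minus
HasCard-Valid plus minus leftOne       = HasCard-⊤
HasCard-Valid plus minus leftMinusOne  = HasCard-⊤
HasCard-Valid plus minus rightOne      = HasCard-⊤
HasCard-Valid plus minus rightMinusOne = HasCard-⊤
HasCard-Valid {d} plus minus opposite  = HasCard-≡0 (d % 2)

byMagnitude : ℕ → ℕ → Kind
byMagnitude m n with <-cmp m n
... | tri< _ _ _ = sumAsc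
... | tri≈ _ _ _ = opposite
... | tri> _ _ _ = sumDesc

-- The pairs (+ m , - n) never lie in 𝓜(d), so their kind is irrelevant.
kindOf : ℤ × ℤ → Kind
kindOf (+ 1      , _)        = leftOne
kindOf (-[1+ 0 ] , _)        = leftMinusOne
kindOf (_        , + 1)      = rightOne
kindOf (_        , -[1+ 0 ]) = rightMinusOne
kindOf (+ _      , _)        = diffPos
kindOf (-[1+ _ ] , -[1+ _ ]) = diffNeg
kindOf (-[1+ m ] , + n)      = byMagnitude (suc m) n

kindOf-⁺⁺ : ∀ {m n} → 2 ≤ m → 2 ≤ n → kindOf (+ m , + n) ≡ diffPos
kindOf-⁺⁺ (s≤s (s≤s _)) (s≤s (s≤s _)) = refl

kindOf-⁻⁻ : ∀ {m n} → 2 ≤ m → 2 ≤ n → kindOf (neg m , neg n) ≡ diffNeg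
kindOf-⁻⁻ (s≤s (s≤s _)) (s≤s (s≤s _)) = refl

kindOf-⁻⁺< : ∀ {m n} → 2 ≤ m → m < n → kindOf (neg m , + n) ≡ sumAsc
kindOf-⁻⁺< {m} {n} (s≤s (s≤s _)) m<n@(s≤s (s≤s (s≤s _))) with <-cmp m n
... | tri< _ _ _   = refl
... | tri≈ m≮n _ _ = contradiction m<n m≮n
... | tri> m≮n _ _ = contradiction m<n m≮n

kindOf-⁻⁺> : ∀ {m n} → 2 ≤ n → n < m → kindOf (neg m , + n) ≡ sumDesc
kindOf-⁻⁺> {m} {n} (s≤s (s≤s _)) n<m@(s≤s (s≤s (s≤s _))) with <-cmp m n
... | tri< _ _ n≮m = contradiction n<m n≮m
... | tri≈ _ _ n≮m = contradiction n<m n≮m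
... | tri> _ _ _   = refl

kindOf-⁻⁺≡ : ∀ {m} → 2 ≤ m → kindOf (neg m , + m) ≡ opposite
kindOf-⁻⁺≡ {m} (s≤s (s≤s _)) with <-cmp m m
... | tri< _ m≢m _ = contradiction refl m≢m
... | tri≈ _ _ _   = refl
... | tri> _ m≢m _ = contradiction refl m≢m

even⇒≡half+half : ∀ {d} → d % 2 ≡ 0 → d ≡ d / 2 + d / 2
even⇒≡half+half {d} d%2≡0 = begin
  d                   ≡⟨ m≡m%n+[m/n]*n d 2 ⟩
  d % 2 + d / 2 * 2   ≡⟨ cong (_+ d / 2 * 2) d%2≡0 ⟩
  d / 2 * 2           ≡⟨ *-comm (d / 2) 2 ⟩
  d / 2 + (d / 2 + 0) ≡⟨ cong (_+_ (d / 2)) (+-identityʳ (d / 2)) ⟩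
  d / 2 + d / 2       ∎
  where open ≡-Reasoning

3≤n+n⇒2≤n : ∀ {n} → 3 ≤ n + n → 2 ≤ n
3≤n+n⇒2≤n {suc (suc _)} _         = s≤s (s≤s z≤n)
3≤n+n⇒2≤n {suc zero}    (s≤s (s≤s ()))

2≤half : ∀ {d} → 3 ≤ d → d % 2 ≡ 0 → 2 ≤ d / 2
2≤half 3≤d d%2≡0 = 3≤n+n⇒2≤n (≤-trans 3≤d (≤-reflexive (even⇒≡half+half d%2≡0)))

half-double : ∀ n → (n + n) / 2 ≡ n × (n + n) % 2 ≡ 0
half-double n = trans (cong (_/ 2) n+n≡n*2) (m*n/n≡m n 2) , trans (cong (_% 2) n+n≡n*2) (m*n%n≡0 n 2)
  where
  n+n≡n*2 : n + n ≡ n * 2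
  n+n≡n*2 = trans (cong (_+_ n) (sym (+-identityʳ n))) (*-comm 2 n)

neg-injective : ∀ {m n} → neg m ≡ neg n → m ≡ n
neg-injective = ℤP.+-injective ∘ ℤP.neg-injective

inM : ∀ {a b c} p q → ¬ a ≡ 0ℤ → ¬ b ≡ 0ℤ → ¬ (p ≡ 0 × q ≡ 0) → ∣ a ∣ ^ p ≡ ∣ b ∣ ^ q → b ℤ.- a ≡ c → InM c (a , b)
inM p q a≢0 b≢0 pq≢0 e b-a≡c = i*j≢0 a≢0 b≢0 , ^≡^⇒multDep {p = p} {q} a≢0 b≢0 pq≢0 e , b-a≡c

inM-commonBase : ∀ {a b c} g x y → 1 ≤ g → 1 ≤ x → ∣ a ∣ ≡ g ^ x → ∣ b ∣ ≡ g ^ y → b ℤ.- a ≡ c → InM c (a , b)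
inM-commonBase {a} {b} g@(suc _) x y _ 1≤x ∣a∣≡g^x ∣b∣≡g^y =
  inM y x (nonzero {n = x} ∣a∣≡g^x) (nonzero {n = y} ∣b∣≡g^y) (λ (_ , x≡0) → <⇒≢ 1≤x (sym x≡0)) (begin
    ∣ a ∣ ^ y       ≡⟨ cong (_^ y) ∣a∣≡g^x ⟩
    (g ^ x) ^ y     ≡⟨ ^-comm g x y ⟩
    (g ^ y) ^ x     ≡⟨ cong (_^ x) ∣b∣≡g^y ⟨
    ∣ b ∣ ^ x       ∎)
  where
  open ≡-Reasoning
  nonzero : ∀ {i n} → ∣ i ∣ ≡ g ^ n → ¬ i ≡ 0ℤ
  nonzero {n = n} ∣i∣≡g^n refl = <⇒≢ (m^n>0 g n) ∣i∣≡g^n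

pair-kind : ∀ {d} → 3 ≤ d → ∀ k {t} → Valid d k t → kindOf (pair d k t) ≡ k
pair-kind _ sumAsc  (2≤g , 1≤x , x<y , _) = kindOf-⁻⁺< (2≤m^n 2≤g 1≤x) (^-monoʳ-< _ 2≤g x<y)
pair-kind _ sumDesc (2≤g , 1≤x , x<y , _) = kindOf-⁻⁺> (2≤m^n 2≤g 1≤x) (^-monoʳ-< _ 2≤g x<y)
pair-kind _ diffPos (2≤g , 1≤x , x<y , _) = kindOf-⁺⁺ (2≤m^n 2≤g 1≤x) (2≤m^n 2≤g (≤-trans 1≤x (<⇒≤ x<y)))
pair-kind _ diffNeg (2≤g , 1≤x , x<y , _) = kindOf-⁻⁻ (2≤m^n 2≤g (≤-trans 1≤x (<⇒≤ x<y))) (2≤m^n 2≤g 1≤x)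
pair-kind _                   leftOne       _     = refl
pair-kind _                   leftMinusOne  _     = refl
pair-kind (s≤s (s≤s (s≤s _))) rightOne      _     = refl
pair-kind (s≤s (s≤s (s≤s _))) rightMinusOne _     = refl
pair-kind 3≤d                 opposite      d%2≡0 = kindOf-⁻⁺≡ (2≤half 3≤d d%2≡0)

pair-injective : ∀ {d} k {t t′} → Valid d k t → Valid d k t′ → pair d k t ≡ pair d k t′ → t ≡ t′
pair-injective sumAsc (2≤g , 1≤x , _ , ¬pp , _) (2≤g′ , 1≤x′ , _ , ¬pp′ , _) e =
  primitivePowers-injective (2≤g , ¬pp) (2≤g′ , ¬pp′) 1≤x 1≤x′ (neg-injective (cong proj₁ e)) (ℤP.+-injective (cong proj₂ e))
pair-injective sumDesc (2≤g , 1≤x , _ , ¬pp , _) (2≤g′ , 1≤x′ , _ , ¬pp′ , _) e =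
  primitivePowers-injective (2≤g , ¬pp) (2≤g′ , ¬pp′) 1≤x 1≤x′ (ℤP.+-injective (cong proj₂ e)) (neg-injective (cong proj₁ e))
pair-injective diffPos (2≤g , 1≤x , _ , ¬pp , _) (2≤g′ , 1≤x′ , _ , ¬pp′ , _) e =
  primitivePowers-injective (2≤g , ¬pp) (2≤g′ , ¬pp′) 1≤x 1≤x′ (ℤP.+-injective (cong proj₁ e)) (ℤP.+-injective (cong proj₂ e))
pair-injective diffNeg (2≤g , 1≤x , _ , ¬pp , _) (2≤g′ , 1≤x′ , _ , ¬pp′ , _) e =
  primitivePowers-injective (2≤g , ¬pp) (2≤g′ , ¬pp′) 1≤x 1≤x′ (neg-injective (cong proj₂ e)) (neg-injective (cong proj₁ e))
pair-injective leftOne       _ _ _ = refl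
pair-injective leftMinusOne  _ _ _ = refl
pair-injective rightOne      _ _ _ = refl
pair-injective rightMinusOne _ _ _ = refl
pair-injective opposite      _ _ _ = refl

pair-sound : ∀ {d} → 3 ≤ d → ∀ k {t} → Valid d k t → InM (+ d) (pair d k t)
pair-sound _ sumAsc {g , x , y} (2≤g , 1≤x , _ , _ , g^y+g^x≡d) =
  inM-commonBase g x y (≤-trans (s≤s z≤n) 2≤g) 1≤x (ℤP.∣-i∣≡∣i∣ (+ (g ^ x))) refl
    (trans ([+m]-[-n]≡+[m+n] (g ^ y) (g ^ x)) (cong +_ g^y+g^x≡d))
pair-sound _ sumDesc {g , x , y} (2≤g , 1≤x , x<y , _ , g^y+g^x≡d) =
  inM-commonBase g y x (≤-trans (s≤s z≤n) 2≤g) (≤-trans 1≤x (<⇒≤ x<y)) (ℤP.∣-i∣≡∣i∣ (+ (g ^ y))) refl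
    (trans ([+m]-[-n]≡+[m+n] (g ^ x) (g ^ y)) (cong +_ (trans (+-comm (g ^ x) (g ^ y)) g^y+g^x≡d)))
pair-sound _ diffPos {g , x , y} (2≤g , 1≤x , _ , _ , g^y≡d+g^x) =
  inM-commonBase g x y (≤-trans (s≤s z≤n) 2≤g) 1≤x refl refl (from [+m]-[+n]≡+k⇔m≡k+n g^y≡d+g^x)
pair-sound _ diffNeg {g , x , y} (2≤g , 1≤x , x<y , _ , g^y≡d+g^x) =
  inM-commonBase g y x (≤-trans (s≤s z≤n) 2≤g) (≤-trans 1≤x (<⇒≤ x<y)) (ℤP.∣-i∣≡∣i∣ (+ (g ^ y))) (ℤP.∣-i∣≡∣i∣ (+ (g ^ x)))
    (from [-m]-[-n]≡+k⇔n≡k+m g^y≡d+g^x)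
pair-sound _ leftOne _ = inM 1 0 (λ ()) (λ ()) (λ ()) refl refl
pair-sound (s≤s (s≤s (s≤s {n = k} _))) leftMinusOne _ =
  inM 1 0 (λ ()) (λ ()) (λ ()) refl (trans ([+m]-[-n]≡+[m+n] (suc (suc k)) 1) (cong +_ (+-comm (suc (suc k)) 1)))
pair-sound (s≤s (s≤s (s≤s _))) rightOne      _ = inM 0 1 (λ ()) (λ ()) (λ ()) refl refl
pair-sound (s≤s (s≤s (s≤s _))) rightMinusOne _ = inM 0 1 (λ ()) (λ ()) (λ ()) refl refl
pair-sound {d} 3≤d opposite d%2≡0 =
  inM-commonBase (d / 2) 1 1 (≤-trans (s≤s z≤n) (2≤half 3≤d d%2≡0)) ≤-refl
    (trans (ℤP.∣-i∣≡∣i∣ (+ (d / 2))) (sym (*-identityʳ (d / 2)))) (sym (*-identityʳ (d / 2)))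
    (trans ([+m]-[-n]≡+[m+n] (d / 2) (d / 2)) (cong +_ (sym (even⇒≡half+half d%2≡0))))

Image : ℕ → ℤ × ℤ → Set
Image d z = ∃[ k ] ∃[ t ] (Valid d k t × pair d k t ≡ z)

fromPrimitivePowers : ∀ {d a b r X Y} → 1 ≤ d → Primitive r → 1 ≤ X → 1 ≤ Y →
  ∣ a ∣ ≡ r ^ X → ∣ b ∣ ≡ r ^ Y → b ℤ.- a ≡ + d → Image d (a , b)
fromPrimitivePowers {d} {+ A} {+ B} {r} {X} {Y} 1≤d (2≤r , ¬pp) 1≤X _ A≡r^X B≡r^Y b-a≡d =
  diffPos , (r , X , Y) , (2≤r , 1≤X , X<Y , ¬pp , r^Y≡d+r^X) , cong₂ _,_ (cong +_ (sym A≡r^X)) (cong +_ (sym B≡r^Y))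
  where
  B≡d+A = to [+m]-[+n]≡+k⇔m≡k+n b-a≡d
  r^Y≡d+r^X = trans (sym B≡r^Y) (trans B≡d+A (cong (_+_ d) A≡r^X))
  X<Y = ^-cancelʳ-< (≤-trans (s≤s z≤n) 2≤r) (subst₂ _<_ A≡r^X (trans (sym B≡d+A) B≡r^Y) (m<n+m A 1≤d))
fromPrimitivePowers {d} { -[1+ A ]} { -[1+ B ]} {r} {X} {Y} 1≤d (2≤r , ¬pp) _ 1≤Y A≡r^X B≡r^Y b-a≡d =
  diffNeg , (r , Y , X) , (2≤r , 1≤Y , Y<X , ¬pp , r^X≡d+r^Y) , cong₂ _,_ (cong neg (sym A≡r^X)) (cong neg (sym B≡r^Y))
  where
  A≡d+B = to [-m]-[-n]≡+k⇔n≡k+m b-a≡d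
  r^X≡d+r^Y = trans (sym A≡r^X) (trans A≡d+B (cong (_+_ d) B≡r^Y))
  Y<X = ^-cancelʳ-< (≤-trans (s≤s z≤n) 2≤r) (subst₂ _<_ B≡r^Y (trans (sym A≡d+B) A≡r^X) (m<n+m (suc B) 1≤d))
fromPrimitivePowers {d} { -[1+ A ]} {+ B} {r} {X} {Y} _ (2≤r , ¬pp) 1≤X 1≤Y A≡r^X B≡r^Y b-a≡d with <-cmp X Y
... | tri< X<Y _ _ = sumAsc , (r , X , Y) , (2≤r , 1≤X , X<Y , ¬pp , r^Y+r^X≡d) ,
  cong₂ _,_ (cong neg (sym A≡r^X)) (cong +_ (sym B≡r^Y))
  where
  r^Y+r^X≡d = trans (cong₂ _+_ (sym B≡r^Y) (sym A≡r^X)) (ℤP.+-injective (trans (sym ([+m]-[-n]≡+[m+n] B (suc A))) b-a≡d))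
... | tri> _ _ Y<X = sumDesc , (r , Y , X) , (2≤r , 1≤Y , Y<X , ¬pp , r^X+r^Y≡d) ,
  cong₂ _,_ (cong neg (sym A≡r^X)) (cong +_ (sym B≡r^Y))
  where
  r^X+r^Y≡d = trans (cong₂ _+_ (sym A≡r^X) (sym B≡r^Y))
    (trans (+-comm (suc A) B) (ℤP.+-injective (trans (sym ([+m]-[-n]≡+[m+n] B (suc A))) b-a≡d)))
... | tri≈ _ refl _ with trans A≡r^X (sym B≡r^Y) | ℤP.+-injective (trans (sym ([+m]-[-n]≡+[m+n] B (suc A))) b-a≡d)
...   | refl | refl = opposite , tt , proj₂ (half-double B) ,
  cong₂ _,_ (cong neg (proj₁ (half-double B))) (cong +_ (proj₁ (half-double B)))
fromPrimitivePowers {a = + zero}  { -[1+ B ]} _ _ _ _ _ _ ()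
fromPrimitivePowers {a = + suc A} { -[1+ B ]} _ _ _ _ _ _ ()

fromDependence : ∀ {d a b} → 1 ≤ d → 2 ≤ ∣ a ∣ → 2 ≤ ∣ b ∣ → MultDep a b → b ℤ.- a ≡ + d → Image d (a , b)
fromDependence {a = a} {b} 1≤d 2≤∣a∣ 2≤∣b∣ dep b-a≡d
  with p , q , 1≤p , 1≤q , ∣a∣^p≡∣b∣^q ← multDep⇒^≡^ 2≤∣a∣ 2≤∣b∣ dep
     | r , X , prim , 1≤X , ∣a∣≡r^X ← primitiveRoot 2≤∣a∣
     | r′ , Y , prim′ , 1≤Y , ∣b∣≡r′^Y ← primitiveRoot 2≤∣b∣
  with refl ← ^≡^⇒samePrimitiveRoot 1≤p 1≤q ∣a∣^p≡∣b∣^q prim prim′ 1≤X 1≤Y ∣a∣≡r^X ∣b∣≡r′^Y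
  = fromPrimitivePowers 1≤d prim 1≤X 1≤Y ∣a∣≡r^X ∣b∣≡r′^Y b-a≡d

pair-complete : ∀ {d a b} → 3 ≤ d → InM (+ d) (a , b) → Image d (a , b)
pair-complete {a = + zero}       _ (ab≢0 , _) = contradiction refl ab≢0
pair-complete {a = a} {+ zero}   _ (ab≢0 , _) = contradiction (ℤP.*-zeroʳ a) ab≢0
pair-complete {a = + 1} {+ suc B} _ (_ , _ , b-a≡d) =
  leftOne , tt , tt , cong (λ n → + 1 , + suc n) (sym (ℤP.+-injective b-a≡d))
pair-complete {a = -[1+ 0 ]} {+ suc B} _ (_ , _ , b-a≡d) =
  leftMinusOne , tt , tt , cong (λ n → neg 1 , + n) (trans (cong (_∸ 1) (sym (ℤP.+-injective b-a≡d))) (m+n∸n≡m (suc B) 1))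
pair-complete {a = -[1+ suc A ]} {+ 1} _ (_ , _ , b-a≡d) =
  rightOne , tt , tt , cong (λ n → neg (n ∸ 1) , + 1) (sym (ℤP.+-injective b-a≡d))
pair-complete {a = -[1+ suc A ]} { -[1+ 0 ]} _ (_ , _ , b-a≡d) =
  rightMinusOne , tt , tt , cong (λ n → neg (suc n) , neg 1) (sym (ℤP.+-injective b-a≡d))
pair-complete {a = + 1}           { -[1+ B ]}     _                   (_ , _ , ())
pair-complete {a = -[1+ 0 ]}      { -[1+ zero ]}  (s≤s (s≤s (s≤s _))) (_ , _ , ())
pair-complete {a = -[1+ 0 ]}      { -[1+ suc B ]} _                   (_ , _ , ())
pair-complete {a = + suc (suc A)} {+ 1}           _                   (_ , _ , ())
pair-complete {a = + suc (suc A)} { -[1+ 0 ]}     _                   (_ , _ , ())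
pair-complete {a = + suc (suc _)}  {+ suc (suc _)}  3≤d (_ , dep , b-a≡d) =
  fromDependence (≤-trans (s≤s z≤n) 3≤d) (s≤s (s≤s z≤n)) (s≤s (s≤s z≤n)) dep b-a≡d
pair-complete {a = + suc (suc _)}  { -[1+ suc _ ]} 3≤d (_ , dep , b-a≡d) =
  fromDependence (≤-trans (s≤s z≤n) 3≤d) (s≤s (s≤s z≤n)) (s≤s (s≤s z≤n)) dep b-a≡d
pair-complete {a = -[1+ suc _ ]} {+ suc (suc _)}  3≤d (_ , dep , b-a≡d) =
  fromDependence (≤-trans (s≤s z≤n) 3≤d) (s≤s (s≤s z≤n)) (s≤s (s≤s z≤n)) dep b-a≡d
pair-complete {a = -[1+ suc _ ]} { -[1+ suc _ ]} 3≤d (_ , dep , b-a≡d) =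
  fromDependence (≤-trans (s≤s z≤n) 3≤d) (s≤s (s≤s z≤n)) (s≤s (s≤s z≤n)) dep b-a≡d

image⇔InM∩kind : ∀ {d} → 3 ≤ d → ∀ k z → (∃[ t ] (Valid d k t × pair d k t ≡ z)) ⇔ (InM (+ d) z × kindOf z ≡ k)
image⇔InM∩kind {d} 3≤d k (a , b) = mk⇔
  (λ { (t , valid , refl) → pair-sound 3≤d k valid , pair-kind 3≤d k valid })
  (λ (inM , kind≡k) → let k′ , t , valid , pair≡ab = pair-complete 3≤d inM in
    sameKind k′ t valid pair≡ab (trans (sym (pair-kind 3≤d k′ valid)) (trans (cong kindOf pair≡ab) kind≡k)))
  where
  sameKind : ∀ k′ t → Valid d k′ t → pair d k′ t ≡ (a , b) → k′ ≡ k → ∃[ t ] (Valid d k t × pair d k t ≡ (a , b))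
  sameKind k′ t valid pair≡ab refl = t , valid , pair≡ab

kinds-sum : ∀ np nm δ → np + (np + (nm + (nm + (1 + (1 + (1 + (1 + (δ + 0)))))))) ≡ 2 * np + 2 * nm + 4 + δ
kinds-sum = solve-∀

lemma4p1 : (d : ℕ) → 3 ≤ d →
    ∃[ np ] ∃[ nm ]
      (HasCard (PlusSol d) np × HasCard (MinusSol d) nm ×
       HasCard (InM (+ d)) (2 * np + 2 * nm + 4 + δ d))
lemma4p1 d 3≤d with np , plus ← plusSol-finite d | nm , minus ← minusSol-finite d =
  np , nm , plus , minus , subst (HasCard (InM (+ d))) (kinds-sum np nm (δ d))
    (HasCard-partition kindOf allKinds-unique ∈-allKinds λ k →
      HasCard-cong (image⇔InM∩kind 3≤d k) (HasCard-image (pair d k) (HasCard-Valid plus minus k) (pair-injective k)))
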